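{- For every global type $G$, message $m$ and queue $\mathcal M$, if $G\parallel m\cdot\mathcal M$ is balanced, then $w(m,G)$ is finite.
   Context: Participants $\mathsf p,\mathsf q,\mathsf r,\mathsf s$; labels $\lambda$. A message is $\langle\mathsf p,\lambda,\mathsf q\rangle$; a queue $\mathcal M$ is a finite sequence of messages ($\emptyset$, $\cdot$), modulo the congruence $\equiv$ generated by $\langle\mathsf p,\lambda,\mathsf q\rangle\cdot\langle\mathsf r,\lambda',\mathsf s\rangle\equiv\langle\mathsf r,\lambda',\mathsf s\rangle\cdot\langle\mathsf p,\lambda,\mathsf q\rangle$ when $\mathsf p\neq\mathsf r$ or $\mathsf q\neq\mathsf s$. Global types: possibly infinite regular terms $G ::= \mathsf{End}\mid \mathsf p\mathsf q!\{\lambda_i;G_i\}_{i\in I}\mid\mathsf p\mathsf q?\{\lambda_i;G_i\}_{i\in I}$ ($I$ finite nonempty, $\mathsf p\neq\mathsf q$, $\lambda_i$ distinct). Readability $\mathrm{read}(G,\mathcal M)$ is defined inductively: $\mathrm{read}(G,\emptyset)$; $\mathrm{read}(\mathsf p\mathsf q!\{\lambda_i;G_i\}_{i\in I},\mathcal M)$ if $\mathrm{read}(G_i,\mathcal M)$ for all $i\in I$; $\mathrm{read}(\mathsf p\mathsf q?\{\lambda_i;G_i\}_{i\in I},\langle\mathsf p,\lambda_h,\mathsf q\rangle\cdot\mathcal M)$ if $h\in I$ and $\mathrm{read}(G_i,\mathcal M)$ for all $i\in I$; $\mathrm{read}(\mathsf p\mathsf q?\{\lambda_i;G_i\}_{i\in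 I},\mathcal M)$ if $\mathcal M\not\equiv\langle\mathsf p,\lambda_i,\mathsf q\rangle\cdot\mathcal M'$ for every $i\in I$ and every $\mathcal M'$, and $\mathrm{read}(G_i,\mathcal M)$ for all $i\in I$. Balancing of $G\parallel\mathcal M$ is defined coinductively: $\mathsf{End}\parallel\emptyset$ is balanced; $G=\mathsf p\mathsf q!\{\lambda_i;G_i\}_{i\in I}$ with $\mathcal M$ is balanced if $\mathrm{read}(G,\mathcal M)$ and $G_i\parallel\mathcal M\cdot\langle\mathsf p,\lambda_i,\mathsf q\rangle$ is balanced for all $i\in I$; $G=\mathsf p\mathsf q?\{\lambda_i;G_i\}_{i\in I}$ with $\langle\mathsf p,\lambda_h,\mathsf q\rangle\cdot\mathcal M$, $h\in I$, is balanced if $\mathrm{read}(G,\langle\mathsf p,\lambda_h,\mathsf q\rangle\cdot\mathcal M)$ and $G_h\parallel\mathcal M$ is balanced. Weight: for a message $m=\langle\mathsf p,\lambda,\mathsf q\rangle$ let $\mathrm{inc}(m)=\mathsf p\mathsf q?\lambda$. The weight $w(m,G)\in\mathbb N\cup\{\infty\}$ is defined corecursively (guarded equations): $w(m,\mathsf{End})=\infty$; $w(m,G)=0$ if $G=\mathsf p\mathsf q?\{\lambda_i;G_i\}_{i\in I}$ and $\mathrm{inc}(m)=\mathsf p\mathsf q?\lambda_h$ for some $h\in I$; $w(m,G)=1+\sup_{i\in I}w(m,G_i)$ if either $G=\mathsf p\mathsf q!\{\lambda_i;G_i\}_{i\in I}$, or $G=\mathsf p\mathsf q?\{\lambda_i;G_i\}_{i\in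 I}$ and $\mathrm{inc}(m)\neq\mathsf p\mathsf q?\lambda_i$ for all $i\in I$. -}

module Defs where

open import Data.Nat using (ℕ; suc)
open import Data.Fin using (Fin)
open import Data.List using (List; []; _∷_; _++_; map)
open import Data.List.Membership.Propositional using (_∈_)
open import Data.List.Relation.Unary.Unique.Propositional using (Unique)
open import Data.Product using (_×_; _,_; proj₁; ∃)
open import Data.Sum using (_⊎_)
open import Data.Empty using (⊥)
open import Data.Unit using (⊤)
open import Relation.Nullary using (¬_)
open import Relation.Binary.PropositionalEquality using (_≡_; _≢_)
open import Relation.Binary.Construct.Closure.Equivalence using (EqClosure)

Ptp : Set
Ptp = ℕ

Label : Set
Label = ℕ

data Message : Set where
  ⟨_,_,_⟩ : Ptp → Label → Ptp → Message

Queue : Set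
Queue = List Message

data Swap : Queue → Queue → Set where
  here  : ∀ {p l q r l′ s M} → (p ≢ r ⊎ q ≢ s) →
          Swap (⟨ p , l , q ⟩ ∷ ⟨ r , l′ , s ⟩ ∷ M) (⟨ r , l′ , s ⟩ ∷ ⟨ p , l , q ⟩ ∷ M)
  there : ∀ {x M M′} → Swap M M′ → Swap (x ∷ M) (x ∷ M′)

_≈_ : Queue → Queue → Set
_≈_ = EqClosure Swap

infix 4 _≈_

NonEmpty : {A : Set} → List A → Set
NonEmpty []      = ⊥
NonEmpty (_ ∷ _) = ⊤

data Node (n : ℕ) : Set where
  end  : Node n
  send : (p q : Ptp) → p ≢ q → (bs : List (Label × Fin n)) →
         NonEmpty bs → Unique (map proj₁ bs) → Node n
  recv : (p q : Ptp) → p ≢ q → (bs : List (Label × Fin n)) →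
         NonEmpty bs → Unique (map proj₁ bs) → Node n

-- A (possibly infinite) regular global type is presented as a finite graph
-- (states Fin size, each labelled by a node) together with a root state;
-- the global type is the (regular) unfolding of the graph from the root.
-- Every regular term arises this way.
record GlobalType : Set where
  field
    size : ℕ
    node : Fin size → Node size
    root : Fin size

module _ (Γ : GlobalType) where
  open GlobalType Γ

  data Read : Fin size → Queue → Set where
    r-∅  : ∀ {s} → Read s []
    r-!  : ∀ {s M p q d bs ne u} → node s ≡ send p q d bs ne u →
           (∀ {l t} → (l , t) ∈ bs → Read t M) → Read s M
    r-?h : ∀ {s M M′ p q d bs ne u l} → node s ≡ recv p q d bs ne u →
           M ≈ ⟨ p , l , q ⟩ ∷ M′ → l ∈ map proj₁ bs →
           (∀ {l′ t} → (l′ , t) ∈ bs → Read t M′) → Read s M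
    r-?n : ∀ {s M p q d bs ne u} → node s ≡ recv p q d bs ne u →
           (∀ {l} → l ∈ map proj₁ bs → ∀ M′ → ¬ (M ≈ ⟨ p , l , q ⟩ ∷ M′)) →
           (∀ {l′ t} → (l′ , t) ∈ bs → Read t M) → Read s M

  mutual
    record Balanced (s : Fin size) (M : Queue) : Set where
      coinductive
      field step : BalStep s M

    data BalStep (s : Fin size) (M : Queue) : Set where
      b-end : node s ≡ end → M ≡ [] → BalStep s M
      b-!   : ∀ {p q d bs ne u} → node s ≡ send p q d bs ne u →
              Read s M →
              (∀ {l t} → (l , t) ∈ bs → Balanced t (M ++ (⟨ p , l , q ⟩ ∷ []))) →
              BalStep s M
      b-?   : ∀ {p q d bs ne u l t M′} → node s ≡ recv p q d bs ne u →
              (l , t) ∈ bs → M ≈ ⟨ p , l , q ⟩ ∷ M′ →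
              Read s M → Balanced t M′ → BalStep s M

  -- WeightLe m s k  :⇔  w(m, G_s) ≤ k.
  -- This is the least-fixed-point (inductive) reading of the guarded equations
  -- for w with values in ℕ ∪ {∞}: w(m,G_s) ≤ k iff the bound is established by
  -- finitely many unfoldings; End gives no bound (w = ∞).
  -- Note inc(m) = pq?λ  iff  m = ⟨p,λ,q⟩.
  data WeightLe (m : Message) : Fin size → ℕ → Set where
    w-0 : ∀ {s k p q d bs ne u l} → node s ≡ recv p q d bs ne u →
          l ∈ map proj₁ bs → m ≡ ⟨ p , l , q ⟩ → WeightLe m s k
    w-! : ∀ {s k p q d bs ne u} → node s ≡ send p q d bs ne u →
          (∀ {l t} → (l , t) ∈ bs → WeightLe m t k) → WeightLe m s (suc k)
    w-? : ∀ {s k p q d bs ne u} → node s ≡ recv p q d bs ne u →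
          (∀ {l} → l ∈ map proj₁ bs → m ≢ ⟨ p , l , q ⟩) →
          (∀ {l t} → (l , t) ∈ bs → WeightLe m t k) → WeightLe m s (suc k)

  WeightFinite : Message → Fin size → Set
  WeightFinite m s = ∃ λ k → WeightLe m s k

_∥_balanced : GlobalType → Queue → Set
G ∥ M balanced = Balanced G (GlobalType.root G) M

weightFinite : Message → GlobalType → Set
weightFinite m G = WeightFinite G m (GlobalType.root G)

{-# OPTIONS --safe #-}
module Submission where

-- Readability of G ∥ m·M is part of its balancing. A derivation of read(G, Q)
-- with m ∈ Q is finite and finitely branching, and along each of its paths m
-- stays in the queue (queue congruence only permutes messages) until a
-- receive matching inc(m) is met; reaching the empty queue is impossible.
-- Hence every path of G from the root meets a matching receive within a
-- uniform number of steps, which bounds w(m, G).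

open import Defs
open import Data.List using (List; []; _∷_; map)

open import Data.Fin using (Fin)
open import Data.Nat using (suc; _≤_; _⊔_; s≤s)
open import Data.Nat.Properties using (_≟_; m≤m⊔n; m≤n⊔m)
open import Data.List.Relation.Unary.Any as Any using (here; there)
open import Data.List.Membership.Propositional using (_∈_)
open import Data.List.Membership.DecPropositional _≟_ using (_∈?_)
open import Data.List.Relation.Binary.Permutation.Propositional using (_↭_; ↭-refl; ↭-prep; ↭-swap; ↭-trans; ↭-sym)
open import Data.List.Relation.Binary.Permutation.Propositional.Properties using (∈-resp-↭)
open import Relation.Binary.Construct.Closure.ReflexiveTransitive using (ε; _◅_)
open import Relation.Binary.Construct.Closure.Symmetric using (fwd; bwd)
open import Data.Product using (_×_; _,_; proj₁; ∃)
open import Data.Sum using (_⊎_; inj₁; inj₂)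
open import Relation.Nullary using (yes; no)
open import Relation.Binary.PropositionalEquality using (_≡_; _≢_; refl)

Swap⇒↭ : ∀ {Q Q′} → Swap Q Q′ → Q ↭ Q′
Swap⇒↭ (here {p} {l} {q} {r} {l′} {s} _) = ↭-swap ⟨ p , l , q ⟩ ⟨ r , l′ , s ⟩ ↭-refl
Swap⇒↭ (there {x} sw)                    = ↭-prep x (Swap⇒↭ sw)

≈⇒↭ : ∀ {Q Q′} → Q ≈ Q′ → Q ↭ Q′
≈⇒↭ ε             = ↭-refl
≈⇒↭ (fwd sw ◅ eq) = ↭-trans (Swap⇒↭ sw) (≈⇒↭ eq)
≈⇒↭ (bwd sw ◅ eq) = ↭-trans (↭-sym (Swap⇒↭ sw)) (≈⇒↭ eq)

∈-resp-≈ : ∀ {x Q Q′} → x ∈ Q → Q ≈ Q′ → x ∈ Q′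
∈-resp-≈ x∈Q Q≈Q′ = ∈-resp-↭ (≈⇒↭ Q≈Q′) x∈Q

inc-matches? : (m : Message) (p q : Ptp) (ls : List Label) →
  (∃ λ l → l ∈ ls × m ≡ ⟨ p , l , q ⟩) ⊎ (∀ {l} → l ∈ ls → m ≢ ⟨ p , l , q ⟩)
inc-matches? ⟨ p′ , l , q′ ⟩ p q ls with p′ ≟ p | q′ ≟ q | l ∈? ls
... | yes refl | yes refl | yes l∈ls = inj₁ (l , l∈ls , refl)
... | yes refl | yes refl | no  l∉ls = inj₂ λ { l∈ls refl → l∉ls l∈ls }
... | yes _    | no  q′≢q | _        = inj₂ λ { _ refl → q′≢q refl }
... | no  p′≢p | _        | _        = inj₂ λ { _ refl → p′≢p refl }

module _ (Γ : GlobalType) (m : Message) where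
  open GlobalType Γ

  WeightLe-mono : ∀ {s k k′} → k ≤ k′ → WeightLe Γ m s k → WeightLe Γ m s k′
  WeightLe-mono _         (w-0 e l∈ m≡) = w-0 e l∈ m≡
  WeightLe-mono (s≤s k≤k′) (w-! e ws)    = w-! e λ lt∈ → WeightLe-mono k≤k′ (ws lt∈)
  WeightLe-mono (s≤s k≤k′) (w-? e m≢ ws) = w-? e m≢ λ lt∈ → WeightLe-mono k≤k′ (ws lt∈)

  WeightFinite-uniform : (bs : List (Label × Fin size)) →
    (∀ {l t} → (l , t) ∈ bs → WeightFinite Γ m t) →
    ∃ λ k → ∀ {l t} → (l , t) ∈ bs → WeightLe Γ m t k
  WeightFinite-uniform []       _  = 0 , λ ()
  WeightFinite-uniform (b ∷ bs) fs
    with fs (here refl) | WeightFinite-uniform bs (λ lt∈ → fs (there lt∈))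
  ... | k , w | K , ws = k ⊔ K , λ
    { (here refl) → WeightLe-mono (m≤m⊔n k K) w
    ; (there lt∈) → WeightLe-mono (m≤n⊔m k K) (ws lt∈) }

  receive-WeightFinite : ∀ {s p q d bs ne u} → node s ≡ recv p q d bs ne u →
    ((∀ {l} → l ∈ map proj₁ bs → m ≢ ⟨ p , l , q ⟩) →
       ∀ {l t} → (l , t) ∈ bs → WeightFinite Γ m t) →
    WeightFinite Γ m s
  receive-WeightFinite {p = p} {q} {bs = bs} e fs
    with inc-matches? m p q (map proj₁ bs)
  ... | inj₁ (l′ , l′∈ , m≡) = 0 , w-0 e l′∈ m≡
  ... | inj₂ m≢ with WeightFinite-uniform bs (fs m≢)
  ...   | k , ws = suc k , w-? e m≢ ws

  Read⇒WeightFinite : ∀ {s Q} → Read Γ s Q → m ∈ Q → WeightFinite Γ m s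
  Read⇒WeightFinite r-∅ ()
  Read⇒WeightFinite (r-! {bs = bs} e rs) m∈Q
    with WeightFinite-uniform bs (λ lt∈ → Read⇒WeightFinite (rs lt∈) m∈Q)
  ... | k , ws = suc k , w-! e ws
  Read⇒WeightFinite (r-?h e Q≈ l∈ rs) m∈Q = receive-WeightFinite e λ m≢ lt∈ →
    Read⇒WeightFinite (rs lt∈) (Any.tail (m≢ l∈) (∈-resp-≈ m∈Q Q≈))
  Read⇒WeightFinite (r-?n e _ rs) m∈Q = receive-WeightFinite e λ _ lt∈ →
    Read⇒WeightFinite (rs lt∈) m∈Q

  Balanced-nonempty⇒Read : ∀ {s x Q} → Balanced Γ s (x ∷ Q) → Read Γ s (x ∷ Q)
  Balanced-nonempty⇒Read b with Balanced.step b
  ... | b-end _ ()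
  ... | b-! _ r _     = r
  ... | b-? _ _ _ r _ = r

lemma4p16 : (G : GlobalType) (m : Message) (M : Queue) →
    G ∥ (m ∷ M) balanced → weightFinite m G
lemma4p16 G m M b = Read⇒WeightFinite G m (Balanced-nonempty⇒Read G m b) (here refl)
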